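{- Let $n$ be an even Zumkeller number with prime factorization $n=2^kp_1^{k_1}p_2^{k_2}\cdots p_m^{k_m}$, where $2<p_1<\cdots<p_m$. If $n$ is not a half-Zumkeller number, then there exists $i$ with $1\le i\le m$ such that $p_i>\sigma(2^kp_1^{k_1}\cdots p_{i-1}^{k_{i-1}})+1$. Moreover, if $j$ is the smallest such $i$, then $k_1,\ldots,k_{j-1}$ are all even and $j\le m-1$.
   Context: $\sigma(x)$ denotes the sum of all positive divisors of $x$ (for $i=1$ the product $2^kp_1^{k_1}\cdots p_{i-1}^{k_{i-1}}$ is $2^k$). A positive integer $n$ is a Zumkeller number if the set of all positive divisors of $n$ can be partitioned into two disjoint parts whose sums are equal. A positive integer $n$ is a half-Zumkeller number if the set of all positive divisors of $n$ other than $n$ itself can be partitioned into two disjoint parts whose sums are equal. -}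

module Defs where

open import Data.Bool using (Bool; not)
open import Data.Nat using (ℕ; zero; suc; _*_; _^_; _≤_; _<_)
open import Data.Nat.Divisibility using (_∣?_)
open import Data.List using (List; filter; filterᵇ; map; upTo)
open import Data.Nat.ListAction using (sum)
open import Data.Product using (∃)
open import Relation.Binary.PropositionalEquality using (_≡_)

divisors : ℕ → List ℕ
divisors n = filter (_∣? n) (map suc (upTo n))

properDivisors : ℕ → List ℕ
properDivisors n = filter (_∣? n) (map suc (upTo (n Data.Nat.∸ 1)))

σ : ℕ → ℕ
σ x = sum (divisors x)

-- a list (of distinct elements) can be split into two disjoint parts of equal sum;
-- the split is given by a colouring c : part 1 = {d | c d = true}, part 2 = the rest
EqualSumPartition : List ℕ → Set
EqualSumPartition ds =
  ∃ λ (c : ℕ → Bool) → sum (filterᵇ c ds) ≡ sum (filterᵇ (λ d → not (c d)) ds)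

Zumkeller : ℕ → Set
Zumkeller n = EqualSumPartition (divisors n)

HalfZumkeller : ℕ → Set
HalfZumkeller n = EqualSumPartition (properDivisors n)

prodTo : (ℕ → ℕ) → ℕ → ℕ
prodTo f zero = 1
prodTo f (suc i) = prodTo f i * f (suc i)

-- 2^k p_1^{k_1} ⋯ p_{i-1}^{k_{i-1}}  (for i = 1 this is 2^k); indices are 1-based
prefixProd : ℕ → (ℕ → ℕ) → (ℕ → ℕ) → ℕ → ℕ
prefixProd k p e i = 2 ^ k * prodTo (λ l → p l ^ e l) (i Data.Nat.∸ 1)

-- For a prime p ∤ N the divisors of N·p^(a+1) are
-- those of N and p times those of N·p^a, so gluing colourings of the two sets realises r + p·u.
-- Hence, by induction on a: (1) Stewart: if p ≤ σ N + 1 and N is practical (every t ≤ σ N, resp.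
-- t ≤ σ N − N, is a sum of distinct divisors, resp. proper divisors), so is N·p^a; (2) Zumkeller
-- and half-Zumkeller splits of N extend to N·p^a; (3) if σ N is odd and below p, N·p^(a+1) is not
-- Zumkeller (part sums agree mod p); (4) for odd p, σ(N·p^a) ≡ σ N·(a+1) (mod 2).  Practical even
-- numbers with even σ split both ways.  Below the first gap all prefixes are practical by (1): with
-- no gap n would be half-Zumkeller; an odd e_l before the first gap j makes σ(Pr j) even by (4), so
-- Pr j and by (2) n split both ways; so σ(Pr j) is odd and (3) excludes j = m.

module Submission where

open import Defs
open import Data.Bool using (Bool; true; false; not; if_then_else_)
open import Data.List using ([]; _∷_; [_]; _++_; filter; filterᵇ; map; upTo)
open import Data.List.Properties using (map-++; upTo-∷ʳ; map-id)
open import Data.Nat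
open import Data.Nat.Coprimality using (Coprime; coprime-divisor)
open import Data.Nat.Divisibility
open import Data.Nat.DivMod using (_/_; _%_; m≡m%n+[m/n]*n; m%n<n; m<n*o⇒m/o<n; m<n⇒m%n≡m; %-remove-+ʳ; m*n/n≡m)
open import Data.Nat.ListAction using (sum)
open import Data.Nat.ListAction.Properties using (sum-++)
open import Data.Nat.Primality using (Prime; prime⇒irreducible; prime⇒nonZero; euclidsLemma; prime[2]; ¬prime[1])
open import Data.Nat.Properties
open import Algebra.Properties.CommutativeSemigroup +-commutativeSemigroup using (interchange)
open import Algebra.Properties.CommutativeSemigroup *-commutativeSemigroup using (x∙yz≈y∙xz)
open import Data.Nat.Tactic.RingSolver using (solve-∀)
open import Data.Parity.Base using (Parity; 0ℙ; 1ℙ; _⁻¹) renaming (_+_ to _+ℙ_; _*_ to _*ℙ_)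
open import Data.Parity.Properties using (+-homo-+; *-homo-*)
import Data.Parity.Properties as ℙ
open import Data.Product using (_×_; _,_; ∃; proj₁; proj₂)
open import Data.Sum using (inj₁; inj₂)
open import Function using (id; _∘_)
open import Relation.Nullary using (¬_; yes; no; does; contradiction)
open import Relation.Nullary.Decidable using (dec-true; dec-false)
open import Relation.Binary.PropositionalEquality using (_≡_; _≢_; refl; sym; trans; cong; cong₂; subst; subst₂; module ≡-Reasoning)
open ≡-Reasoning

rangeSum : (ℕ → ℕ) → ℕ → ℕ
rangeSum h zero    = 0
rangeSum h (suc M) = rangeSum h M + h (suc M)

rangeSum-cong : ∀ {f g} M → (∀ d → 1 ≤ d → d ≤ M → f d ≡ g d) → rangeSum f M ≡ rangeSum g M
rangeSum-cong zero    f≗g = refl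
rangeSum-cong (suc M) f≗g =
  cong₂ _+_ (rangeSum-cong M (λ d 1≤d d≤M → f≗g d 1≤d (m≤n⇒m≤1+n d≤M))) (f≗g (suc M) z<s ≤-refl)

rangeSum-+ : ∀ f g M → rangeSum (λ d → f d + g d) M ≡ rangeSum f M + rangeSum g M
rangeSum-+ f g zero    = refl
rangeSum-+ f g (suc M) = begin
  rangeSum (λ d → f d + g d) M + (f (suc M) + g (suc M))
    ≡⟨ cong (_+ (f (suc M) + g (suc M))) (rangeSum-+ f g M) ⟩
  rangeSum f M + rangeSum g M + (f (suc M) + g (suc M))
    ≡⟨ interchange (rangeSum f M) (rangeSum g M) (f (suc M)) (g (suc M)) ⟩
  rangeSum f M + f (suc M) + (rangeSum g M + g (suc M)) ∎

rangeSum-* : ∀ c f M → rangeSum (λ d → c * f d) M ≡ c * rangeSum f M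
rangeSum-* c f zero    = sym (*-zeroʳ c)
rangeSum-* c f (suc M) =
  trans (cong (_+ c * f (suc M)) (rangeSum-* c f M)) (sym (*-distribˡ-+ c (rangeSum f M) (f (suc M))))

rangeSum-vanishingTail : ∀ {f} N M → N ≤ M → (∀ d → N < d → d ≤ M → f d ≡ 0) →
                         rangeSum f M ≡ rangeSum f N
rangeSum-vanishingTail N zero    z≤n _ = refl
rangeSum-vanishingTail {f} N (suc M) N≤1+M vanish with m≤n⇒m<n∨m≡n N≤1+M
... | inj₂ refl = refl
... | inj₁ N<1+M = begin
  rangeSum f M + f (suc M) ≡⟨ cong (rangeSum f M +_) (vanish (suc M) N<1+M ≤-refl) ⟩
  rangeSum f M + 0         ≡⟨ +-identityʳ _ ⟩
  rangeSum f M             ≡⟨ rangeSum-vanishingTail N M (≤-pred N<1+M) (λ d N<d → vanish d N<d ∘ m≤n⇒m≤1+n) ⟩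
  rangeSum f N             ∎

¬∣-betweenMultiples : ∀ {p d} M → p * M < d → d < p * suc M → ¬ p ∣ d
¬∣-betweenMultiples {p} {d} M pM<d d<p[1+M] (divides q refl) =
  <⇒≱ (*-cancelˡ-< p M q (subst (p * M <_) (*-comm q p) pM<d))
      (≤-pred (*-cancelˡ-< p q (suc M) (subst (_< p * suc M) (*-comm q p) d<p[1+M])))

rangeSum-multiples : ∀ p .{{_ : NonZero p}} (h : ℕ → ℕ) M →
  rangeSum (λ d → if does (p ∣? d) then h d else 0) (p * M) ≡ rangeSum (λ e → h (p * e)) M
rangeSum-multiples p h zero    = cong (rangeSum (λ d → if does (p ∣? d) then h d else 0)) (*-zeroʳ p)
rangeSum-multiples p h (suc M) = begin
  rangeSum f (p * suc M)                       ≡⟨ cong (rangeSum f) p[1+M]≡1+X ⟩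
  rangeSum f X + f (suc X)                     ≡⟨ cong₂ _+_ (rangeSum-vanishingTail (p * M) X pM≤X noMultiples) f[1+X] ⟩
  rangeSum f (p * M) + h (p * suc M)           ≡⟨ cong (_+ h (p * suc M)) (rangeSum-multiples p h M) ⟩
  rangeSum (λ e → h (p * e)) M + h (p * suc M) ∎
  where
  f : ℕ → ℕ
  f d = if does (p ∣? d) then h d else 0
  X : ℕ
  X = pred p + p * M
  p[1+M]≡1+X : p * suc M ≡ suc X
  p[1+M]≡1+X = trans (*-suc p M) (cong (_+ p * M) (sym (suc-pred p)))
  pM≤X : p * M ≤ X
  pM≤X = m≤n+m (p * M) (pred p)
  noMultiples : ∀ d → p * M < d → d ≤ X → f d ≡ 0
  noMultiples d pM<d d≤X = cong (if_then h d else 0)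
    (dec-false (p ∣? d) (¬∣-betweenMultiples M pM<d (subst (d <_) (sym p[1+M]≡1+X) (s≤s d≤X))))
  f[1+X] : f (suc X) ≡ h (p * suc M)
  f[1+X] = trans (cong f (sym p[1+M]≡1+X)) (cong (if_then h (p * suc M) else 0) (dec-true (p ∣? p * suc M) (m∣m*n (suc M))))

divSum : (ℕ → ℕ) → ℕ → ℕ
divSum g M = rangeSum (λ d → if does (d ∣? M) then g d else 0) M

divSum-cong : ∀ {g g'} M → (∀ d → d ∣ M → g d ≡ g' d) → divSum g M ≡ divSum g' M
divSum-cong {g} {g'} M g≗g' = rangeSum-cong M termwise
  where
  termwise : ∀ d → 1 ≤ d → d ≤ M → (if does (d ∣? M) then g d else 0) ≡ (if does (d ∣? M) then g' d else 0)
  termwise d _ _ with d ∣? M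
  ... | yes d∣M = g≗g' d d∣M
  ... | no  _   = refl

divSum-+ : ∀ f g M → divSum (λ d → f d + g d) M ≡ divSum f M + divSum g M
divSum-+ f g M = trans (rangeSum-cong M termwise) (rangeSum-+ _ _ M)
  where
  termwise : ∀ d → 1 ≤ d → d ≤ M → (if does (d ∣? M) then f d + g d else 0)
                                   ≡ (if does (d ∣? M) then f d else 0) + (if does (d ∣? M) then g d else 0)
  termwise d _ _ with d ∣? M
  ... | yes _ = refl
  ... | no  _ = refl

divSum-* : ∀ c f M → divSum (λ d → c * f d) M ≡ c * divSum f M
divSum-* c f M = trans (rangeSum-cong M termwise) (rangeSum-* c _ M)
  where
  termwise : ∀ d → 1 ≤ d → d ≤ M → (if does (d ∣? M) then c * f d else 0) ≡ c * (if does (d ∣? M) then f d else 0)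
  termwise d _ _ with d ∣? M
  ... | yes _ = refl
  ... | no  _ = sym (*-zeroʳ c)

-- The divisors of p·M, sorted by whether p divides them: if N ∣ M, p ∤ N and every divisor
-- of p·M prime to p divides N, these are the divisors of N and p times the divisors of M.
divSum-split : ∀ {p N M} .{{_ : NonZero p}} .{{_ : NonZero N}} .{{_ : NonZero M}} →
  ¬ p ∣ N → N ∣ M → (∀ d → ¬ p ∣ d → d ∣ p * M → d ∣ N) →
  ∀ g → divSum g (p * M) ≡ divSum g N + divSum (λ e → g (p * e)) M
divSum-split {p} {N} {M} p∤N N∣M p-free g = begin
  rangeSum F (p * M)
    ≡⟨ rangeSum-cong (p * M) byDivisibility ⟩
  rangeSum (λ d → onMultiples d + offMultiples d) (p * M)
    ≡⟨ rangeSum-+ onMultiples offMultiples (p * M) ⟩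
  rangeSum onMultiples (p * M) + rangeSum offMultiples (p * M)
    ≡⟨ +-comm (rangeSum onMultiples (p * M)) _ ⟩
  rangeSum offMultiples (p * M) + rangeSum onMultiples (p * M)
    ≡⟨ cong₂ _+_ (trans (rangeSum-cong (p * M) offMultiples≡G) (rangeSum-vanishingTail N (p * M) N≤pM G-tail))
                 (trans (rangeSum-multiples p F M) (rangeSum-cong M F[p*e])) ⟩
  divSum g N + divSum (λ e → g (p * e)) M ∎
  where
  F G onMultiples offMultiples : ℕ → ℕ
  F d = if does (d ∣? p * M) then g d else 0
  G d = if does (d ∣? N) then g d else 0
  onMultiples  d = if does (p ∣? d) then F d else 0
  offMultiples d = if does (p ∣? d) then 0 else F d

  byDivisibility : ∀ d → 1 ≤ d → d ≤ p * M → F d ≡ onMultiples d + offMultiples d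
  byDivisibility d _ _ with p ∣? d
  ... | yes _ = sym (+-identityʳ _)
  ... | no  _ = refl

  offMultiples≡G : ∀ d → 1 ≤ d → d ≤ p * M → offMultiples d ≡ G d
  offMultiples≡G d _ _ with p ∣? d | d ∣? p * M | d ∣? N
  ... | yes _   | _        | no  _   = refl
  ... | yes p∣d | _        | yes d∣N = contradiction (∣-trans p∣d d∣N) p∤N
  ... | no  _   | yes _    | yes _   = refl
  ... | no  _   | no  _    | no  _   = refl
  ... | no  p∤d | yes d∣pM | no  d∤N = contradiction (p-free d p∤d d∣pM) d∤N
  ... | no  _   | no  d∤pM | yes d∣N = contradiction (∣-trans d∣N (∣-trans N∣M (n∣m*n p))) d∤pM

  G-tail : ∀ d → N < d → d ≤ p * M → G d ≡ 0
  G-tail d N<d _ with d ∣? N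
  ... | yes d∣N = contradiction (∣⇒≤ d∣N) (<⇒≱ N<d)
  ... | no  _   = refl

  N≤pM : N ≤ p * M
  N≤pM = ≤-trans (∣⇒≤ N∣M) (m≤n*m M p)

  F[p*e] : ∀ e → 1 ≤ e → e ≤ M → F (p * e) ≡ (if does (e ∣? M) then g (p * e) else 0)
  F[p*e] e _ _ with p * e ∣? p * M | e ∣? M
  ... | yes _      | yes _   = refl
  ... | no  _      | no  _   = refl
  ... | yes pe∣pM  | no  e∤M = contradiction (*-cancelˡ-∣ p pe∣pM) e∤M
  ... | no  pe∤pM  | yes e∣M = contradiction (*-monoʳ-∣ p e∣M) pe∤pM

inPart : (ℕ → Bool) → ℕ → ℕ
inPart c d = if c d then d else 0

partSum : (ℕ → Bool) → ℕ → ℕ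
partSum c M = divSum (inPart c) M

sum-filterᵇ : ∀ c xs → sum (filterᵇ c xs) ≡ sum (map (inPart c) xs)
sum-filterᵇ c []       = refl
sum-filterᵇ c (x ∷ xs) with c x
... | true  = cong (x +_) (sum-filterᵇ c xs)
... | false = sum-filterᵇ c xs

sum-filter-∣ : ∀ n f xs →
  sum (map f (filter (_∣? n) xs)) ≡ sum (map (λ d → if does (d ∣? n) then f d else 0) xs)
sum-filter-∣ n f []       = refl
sum-filter-∣ n f (x ∷ xs) with x ∣? n
... | yes _ = cong (f x +_) (sum-filter-∣ n f xs)
... | no  _ = sum-filter-∣ n f xs

sum-upTo : ∀ h M → sum (map h (map suc (upTo M))) ≡ rangeSum h M
sum-upTo h zero    = refl
sum-upTo h (suc M) = begin
  sum (map h (map suc (upTo (suc M))))             ≡⟨ cong (sum ∘ map h ∘ map suc) (upTo-∷ʳ M) ⟨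
  sum (map h (map suc (upTo M ++ [ M ])))          ≡⟨ cong (sum ∘ map h) (map-++ suc (upTo M) [ M ]) ⟩
  sum (map h (map suc (upTo M) ++ [ suc M ]))      ≡⟨ cong sum (map-++ h (map suc (upTo M)) [ suc M ]) ⟩
  sum (map h (map suc (upTo M)) ++ [ h (suc M) ])  ≡⟨ sum-++ (map h (map suc (upTo M))) [ h (suc M) ] ⟩
  sum (map h (map suc (upTo M))) + (h (suc M) + 0) ≡⟨ cong₂ _+_ (sum-upTo h M) (+-identityʳ (h (suc M))) ⟩
  rangeSum h M + h (suc M)                         ∎

sum-divisors : ∀ f n → sum (map f (divisors n)) ≡ divSum f n
sum-divisors f n = trans (sum-filter-∣ n f (map suc (upTo n))) (sum-upTo _ n)

σ≡divSum : ∀ n → σ n ≡ divSum id n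
σ≡divSum n = trans (cong sum (sym (map-id (divisors n)))) (sum-divisors id n)

partSum≡ : ∀ c n → sum (filterᵇ c (divisors n)) ≡ partSum c n
partSum≡ c n = trans (sum-filterᵇ c (divisors n)) (sum-divisors (inPart c) n)

properPartSum≡ : ∀ c n → sum (filterᵇ c (properDivisors (suc n))) + inPart c (suc n) ≡ partSum c (suc n)
properPartSum≡ c n = cong₂ _+_
  (trans (sum-filterᵇ c (properDivisors (suc n)))
         (trans (sum-filter-∣ (suc n) (inPart c) (map suc (upTo n))) (sum-upTo _ n)))
  (cong (if_then inPart c (suc n) else 0) (sym (dec-true (suc n ∣? suc n) ∣-refl)))

partSum-complement : ∀ c M → partSum c M + partSum (λ d → not (c d)) M ≡ σ M
partSum-complement c M = begin
  partSum c M + partSum (λ d → not (c d)) M               ≡⟨ divSum-+ (inPart c) (inPart (λ d → not (c d))) M ⟨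
  divSum (λ d → inPart c d + inPart (λ d → not (c d)) d) M ≡⟨ divSum-cong M (λ d _ → bothParts d) ⟩
  divSum id M                                             ≡⟨ σ≡divSum M ⟨
  σ M                                                     ∎
  where
  bothParts : ∀ d → inPart c d + inPart (λ d → not (c d)) d ≡ d
  bothParts d with c d
  ... | true  = +-identityʳ d
  ... | false = refl

n≤σn : ∀ n .{{_ : NonZero n}} → n ≤ σ n
n≤σn (suc n) = subst (suc n ≤_) (sym (trans (σ≡divSum (suc n)) lastTerm)) (m≤n+m (suc n) (rangeSum f n))
  where
  f : ℕ → ℕ
  f d = if does (d ∣? suc n) then d else 0
  lastTerm : divSum id (suc n) ≡ rangeSum f n + suc n
  lastTerm = cong (λ b → rangeSum f n + (if b then suc n else 0)) (dec-true (suc n ∣? suc n) ∣-refl)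

ZumkellerSplit : ℕ → Set
ZumkellerSplit N = ∃ λ c → partSum c N ≡ partSum (λ d → not (c d)) N

-- the same for the proper divisors: N itself lies in the `false` part and is not counted
HalfZumkellerSplit : ℕ → Set
HalfZumkellerSplit N = ∃ λ c → c N ≡ false × partSum c N + N ≡ partSum (λ d → not (c d)) N

Zumkeller⇒split : ∀ n → Zumkeller n → ZumkellerSplit n
Zumkeller⇒split n (c , balanced) = c , trans (sym (partSum≡ c n)) (trans balanced (partSum≡ (λ d → not (c d)) n))

ZumkellerSplit⇒2∣σ : ∀ N → ZumkellerSplit N → 2 ∣ σ N
ZumkellerSplit⇒2∣σ N (c , balanced) = divides (partSum c N) (begin
  σ N                                       ≡⟨ partSum-complement c N ⟨
  partSum c N + partSum (λ d → not (c d)) N ≡⟨ cong (partSum c N +_) balanced ⟨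
  partSum c N + partSum c N                 ≡⟨ cong (partSum c N +_) (+-identityʳ (partSum c N)) ⟨
  2 * partSum c N                           ≡⟨ *-comm 2 (partSum c N) ⟩
  partSum c N * 2                           ∎)

split⇒HalfZumkeller : ∀ n .{{_ : NonZero n}} → HalfZumkellerSplit n → HalfZumkeller n
split⇒HalfZumkeller (suc n) (c , cN≡false , balanced) = c , +-cancelʳ-≡ (suc n) _ _ (begin
  proper c + suc n                                    ≡⟨ cong (_+ suc n) (+-identityʳ (proper c)) ⟨
  proper c + 0 + suc n                                ≡⟨ cong (λ x → proper c + x + suc n) excluded ⟨
  proper c + inPart c (suc n) + suc n                 ≡⟨ cong (_+ suc n) (properPartSum≡ c n) ⟩
  partSum c (suc n) + suc n                           ≡⟨ balanced ⟩
  partSum c̄ (suc n)                                   ≡⟨ properPartSum≡ c̄ n ⟨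
  proper c̄ + inPart c̄ (suc n)                         ≡⟨ cong (proper c̄ +_) included ⟩
  proper c̄ + suc n                                    ∎)
  where
  c̄ : ℕ → Bool
  c̄ d = not (c d)
  proper : (ℕ → Bool) → ℕ
  proper col = sum (filterᵇ col (properDivisors (suc n)))
  excluded : inPart c (suc n) ≡ 0
  excluded = cong (if_then suc n else 0) cN≡false
  included : inPart c̄ (suc n) ≡ suc n
  included = cong (λ b → if not b then suc n else 0) cN≡false

Practical : ℕ → Set
Practical N = ∀ t → t ≤ σ N → ∃ λ c → partSum c N ≡ t

ProperlyPractical : ℕ → Set
ProperlyPractical N = ∀ t → t + N ≤ σ N → ∃ λ c → c N ≡ false × partSum c N ≡ t

otherPart : ∀ {x y a b} → x + y ≡ a + b → x ≡ a → y ≡ b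
otherPart {x} {y} {a} {b} x+y≡a+b refl = +-cancelˡ-≡ x y b x+y≡a+b

-- A practical number with even σ N = 2h is Zumkeller: take a part of sum h.
practical⇒ZumkellerSplit : ∀ N → Practical N → 2 ∣ σ N → ZumkellerSplit N
practical⇒ZumkellerSplit N practical (divides h σN≡h*2) with practical h (subst (h ≤_) (sym σN≡h*2) (m≤m*n h 2))
... | c , cSum≡h = c , trans cSum≡h (sym (otherPart total cSum≡h))
  where
  total : partSum c N + partSum (λ d → not (c d)) N ≡ h + h
  total = trans (partSum-complement c N) (trans σN≡h*2 (trans (*-comm h 2) (cong (h +_) (+-identityʳ h))))

-- If also N = 2w is even, take a proper part of sum h − w; with N added it balances the rest.
properlyPractical⇒HalfZumkellerSplit : ∀ N .{{_ : NonZero N}} → ProperlyPractical N → 2 ∣ σ N → 2 ∣ N →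
                                       HalfZumkellerSplit N
properlyPractical⇒HalfZumkellerSplit N properlyPractical (divides h σN≡h*2) (divides w N≡w*2) =
  c , cN≡false , balanced
  where
  t : ℕ
  t = h ∸ w
  σN≡t+[t+N] : σ N ≡ t + (t + N)
  σN≡t+[t+N] = begin
    σ N             ≡⟨ σN≡h*2 ⟩
    h * 2           ≡⟨ cong (_* 2) (m∸n+n≡m (*-cancelʳ-≤ w h 2 (subst₂ _≤_ N≡w*2 σN≡h*2 (n≤σn N)))) ⟨
    (t + w) * 2     ≡⟨ double t w ⟩
    t + (t + w * 2) ≡⟨ cong (λ x → t + (t + x)) N≡w*2 ⟨
    t + (t + N)     ∎
    where
    double : ∀ t w → (t + w) * 2 ≡ t + (t + w * 2)
    double = solve-∀
  chosen : ∃ λ c → c N ≡ false × partSum c N ≡ t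
  chosen = properlyPractical t (subst (t + N ≤_) (sym σN≡t+[t+N]) (m≤n+m (t + N) t))
  c : ℕ → Bool
  c = proj₁ chosen
  cN≡false : c N ≡ false
  cN≡false = proj₁ (proj₂ chosen)
  balanced : partSum c N + N ≡ partSum (λ d → not (c d)) N
  balanced = trans (cong (_+ N) (proj₂ (proj₂ chosen)))
                   (sym (otherPart (trans (partSum-complement c N) σN≡t+[t+N]) (proj₂ (proj₂ chosen))))

-- Base-p digits with an oversized last digit: if p ≤ s + 1, every t ≤ s + p·B is r + p·u
-- with r ≤ s and u ≤ B.
digitDecomposition : ∀ {s p B t} .{{_ : NonZero p}} → p ≤ suc s → t ≤ s + p * B →
                     ∃ λ r → ∃ λ u → r ≤ s × u ≤ B × t ≡ r + p * u
digitDecomposition {s} {p} {B} {t} p≤1+s t≤s+pB with p * B ≤? t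
... | yes pB≤t = t ∸ p * B , B , m≤n+o⇒m∸n≤o t (p * B) (subst (t ≤_) (+-comm s (p * B)) t≤s+pB) , ≤-refl ,
                 sym (m∸n+n≡m pB≤t)
... | no  pB≰t = t % p , t / p , ≤-pred (≤-trans (m%n<n t p) p≤1+s) ,
                 <⇒≤ (m<n*o⇒m/o<n (subst (t <_) (*-comm p B) (≰⇒> pB≰t))) ,
                 trans (m≡m%n+[m/n]*n t p) (cong (t % p +_) (*-comm (t / p) p))

smallRemainders : ∀ {p x y X Y} .{{_ : NonZero p}} → x < p → y < p → x + p * X ≡ y + p * Y → x ≡ y
smallRemainders {p} {x} {y} {X} {Y} x<p y<p eq = begin
  x                ≡⟨ m<n⇒m%n≡m x<p ⟨
  x % p            ≡⟨ %-remove-+ʳ x (m∣m*n X) ⟨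
  (x + p * X) % p  ≡⟨ cong (_% p) eq ⟩
  (y + p * Y) % p  ≡⟨ %-remove-+ʳ y (m∣m*n Y) ⟩
  y % p            ≡⟨ m<n⇒m%n≡m y<p ⟩
  y                ∎

parity-suc : ∀ n → parity (suc n) ≡ parity n ⁻¹
parity-suc zero          = refl
parity-suc (suc zero)    = refl
parity-suc (suc (suc n)) = parity-suc n

parity≡0ℙ⇒2∣ : ∀ n → parity n ≡ 0ℙ → 2 ∣ n
parity≡0ℙ⇒2∣ zero          _    = divides 0 refl
parity≡0ℙ⇒2∣ (suc (suc n)) even with parity≡0ℙ⇒2∣ n even
... | divides q n≡q*2 = divides (suc q) (cong (suc ∘ suc) n≡q*2)

2∣⇒parity≡0ℙ : ∀ {n} → 2 ∣ n → parity n ≡ 0ℙ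
2∣⇒parity≡0ℙ (divides q refl) = trans (*-homo-* q 2) (ℙ.*-zeroʳ (parity q))

parity-suc-even : ∀ {a} → 2 ∣ a → parity (suc a) ≡ 1ℙ
parity-suc-even {a} 2∣a = trans (parity-suc a) (cong _⁻¹ (2∣⇒parity≡0ℙ 2∣a))

parity-suc-odd : ∀ a → ¬ 2 ∣ a → parity (suc a) ≡ 0ℙ
parity-suc-odd a 2∤a with parity a in eq
... | 0ℙ = contradiction (parity≡0ℙ⇒2∣ a eq) 2∤a
... | 1ℙ = trans (parity-suc a) (cong _⁻¹ eq)

odd⇒¬2∣ : ∀ {n} → parity n ≡ 1ℙ → ¬ 2 ∣ n
odd⇒¬2∣ odd 2∣n with () ← trans (sym odd) (2∣⇒parity≡0ℙ 2∣n)

oddPrime-parity : ∀ {p} → Prime p → 2 < p → parity p ≡ 1ℙ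
oddPrime-parity {p} p-prime 2<p with parity p in eq
... | 1ℙ = refl
... | 0ℙ with prime⇒irreducible p-prime (parity≡0ℙ⇒2∣ p eq)
...   | inj₁ ()
...   | inj₂ refl = contradiction 2<p (<-irrefl refl)

∣p*M⇒∣M : ∀ {p d M} → Prime p → ¬ p ∣ d → d ∣ p * M → d ∣ M
∣p*M⇒∣M {p} {d} p-prime p∤d = coprime-divisor d-coprime-p
  where
  d-coprime-p : Coprime d p
  d-coprime-p (i∣d , i∣p) with prime⇒irreducible p-prime i∣p
  ... | inj₁ i≡1 = i≡1
  ... | inj₂ refl = contradiction i∣d p∤d

module PrimePowerExtension {p N : ℕ} (p-prime : Prime p) (p∤N : ¬ p ∣ N) {{N≢0 : NonZero N}} where

  instance
    p≢0 : NonZero p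
    p≢0 = prime⇒nonZero p-prime

  -- (passed explicitly: instance search cannot recover a from N * p ^ a)
  N*p^a≢0 : ∀ a → NonZero (N * p ^ a)
  N*p^a≢0 a = m*n≢0 N (p ^ a) {{N≢0}} {{m^n≢0 p a}}

  N*p^[1+a] : ∀ a → N * p ^ suc a ≡ p * (N * p ^ a)
  N*p^[1+a] a = x∙yz≈y∙xz N p (p ^ a)

  p-freeDivisor : ∀ {d} a → ¬ p ∣ d → d ∣ N * p ^ a → d ∣ N
  p-freeDivisor {d} zero    p∤d d∣N   = subst (d ∣_) (*-identityʳ N) d∣N
  p-freeDivisor {d} (suc a) p∤d d∣Npa = p-freeDivisor a p∤d (∣p*M⇒∣M p-prime p∤d (subst (d ∣_) (N*p^[1+a] a) d∣Npa))

  divSum-primePower : ∀ a g → divSum g (N * p ^ suc a) ≡ divSum g N + divSum (λ e → g (p * e)) (N * p ^ a)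
  divSum-primePower a g = trans (cong (divSum g) (N*p^[1+a] a))
    (divSum-split {{p≢0}} {{N≢0}} {{N*p^a≢0 a}} p∤N (m∣m*n (p ^ a)) p-free g)
    where
    p-free : ∀ d → ¬ p ∣ d → d ∣ p * (N * p ^ a) → d ∣ N
    p-free d p∤d d∣ = p-freeDivisor (suc a) p∤d (subst (d ∣_) (sym (N*p^[1+a] a)) d∣)

  σ-primePower : ∀ a → σ (N * p ^ suc a) ≡ σ N + p * σ (N * p ^ a)
  σ-primePower a = begin
    σ (N * p ^ suc a)                              ≡⟨ σ≡divSum (N * p ^ suc a) ⟩
    divSum id (N * p ^ suc a)                      ≡⟨ divSum-primePower a id ⟩
    divSum id N + divSum (p *_) (N * p ^ a)        ≡⟨ cong (divSum id N +_) (divSum-* p id (N * p ^ a)) ⟩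
    divSum id N + p * divSum id (N * p ^ a)        ≡⟨ cong₂ (λ x y → x + p * y) (σ≡divSum N) (σ≡divSum (N * p ^ a)) ⟨
    σ N + p * σ (N * p ^ a)                        ∎

  partSum-primePower : ∀ a c → partSum c (N * p ^ suc a) ≡ partSum c N + p * partSum (λ e → c (p * e)) (N * p ^ a)
  partSum-primePower a c = trans (divSum-primePower a (inPart c))
    (cong (partSum c N +_) (trans (divSum-cong (N * p ^ a) (λ e _ → scale e)) (divSum-* p _ (N * p ^ a))))
    where
    scale : ∀ e → inPart c (p * e) ≡ p * inPart (λ e → c (p * e)) e
    scale e with c (p * e)
    ... | true  = refl
    ... | false = sym (*-zeroʳ p)

  glue : (ℕ → Bool) → (ℕ → Bool) → ℕ → Bool
  glue c₁ c₂ d = if does (p ∣? d) then c₂ (d / p) else c₁ d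

  glue-p-free : ∀ c₁ c₂ {d} → ¬ p ∣ d → glue c₁ c₂ d ≡ c₁ d
  glue-p-free c₁ c₂ {d} p∤d = cong (if_then c₂ (d / p) else c₁ d) (dec-false (p ∣? d) p∤d)

  glue-multiple : ∀ c₁ c₂ e → glue c₁ c₂ (p * e) ≡ c₂ e
  glue-multiple c₁ c₂ e = trans (cong (if_then c₂ (p * e / p) else c₁ (p * e)) (dec-true (p ∣? p * e) (m∣m*n e)))
                                (cong c₂ (trans (cong (_/ p) (*-comm p e)) (m*n/n≡m e p)))

  partSum-glue : ∀ (f : Bool → Bool) c₁ c₂ a →
    partSum (λ d → f (glue c₁ c₂ d)) (N * p ^ suc a)
      ≡ partSum (λ d → f (c₁ d)) N + p * partSum (λ e → f (c₂ e)) (N * p ^ a)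
  partSum-glue f c₁ c₂ a = trans (partSum-primePower a (λ d → f (glue c₁ c₂ d))) (cong₂ (λ x y → x + p * y)
    (divSum-cong N (λ d d∣N → cong (λ b → if f b then d else 0)
                                   (glue-p-free c₁ c₂ (λ p∣d → p∤N (∣-trans p∣d d∣N)))))
    (divSum-cong (N * p ^ a) (λ e _ → cong (λ b → if f b then e else 0) (glue-multiple c₁ c₂ e))))

  -- Stewart's criterion: if p ≤ σ N + 1, practicality passes from N to N·p^a; a target
  -- t = r + p·u is reached by gluing a colouring for r on N with one for u on N·p^(a−1).
  practical-primePower : p ≤ suc (σ N) → Practical N → ∀ a → Practical (N * p ^ a)
  practical-primePower _     practical zero = subst Practical (sym (*-identityʳ N)) practical
  practical-primePower p≤1+σ practical (suc a) t t≤σ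
    with digitDecomposition p≤1+σ (subst (t ≤_) (σ-primePower a) t≤σ)
  ... | r , u , r≤σN , u≤σM , t≡r+pu
    with practical r r≤σN | practical-primePower p≤1+σ practical a u u≤σM
  ... | c₁ , sum₁ | c₂ , sum₂ =
    glue c₁ c₂ , trans (partSum-glue id c₁ c₂ a) (trans (cong₂ (λ x y → x + p * y) sum₁ sum₂) (sym t≡r+pu))

  σ-excess : ∀ a → σ (N * p ^ a) ∸ N * p ^ a + N * p ^ a ≡ σ (N * p ^ a)
  σ-excess a = m∸n+n≡m (n≤σn (N * p ^ a) {{N*p^a≢0 a}})

  properTarget-bound : ∀ a t → t + N * p ^ suc a ≤ σ (N * p ^ suc a) →
                       t ≤ σ N + p * (σ (N * p ^ a) ∸ N * p ^ a)
  properTarget-bound a t t+Np^[1+a]≤σ =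
    +-cancelʳ-≤ (p * M) t (σ N + p * B) (subst₂ _≤_ (cong (t +_) (N*p^[1+a] a)) σ-decomposed t+Np^[1+a]≤σ)
    where
    M B : ℕ
    M = N * p ^ a
    B = σ M ∸ M
    σ-decomposed : σ (N * p ^ suc a) ≡ σ N + p * B + p * M
    σ-decomposed = begin
      σ (N * p ^ suc a)     ≡⟨ σ-primePower a ⟩
      σ N + p * σ M         ≡⟨ cong (λ x → σ N + p * x) (σ-excess a) ⟨
      σ N + p * (B + M)     ≡⟨ cong (σ N +_) (*-distribˡ-+ p B M) ⟩
      σ N + (p * B + p * M) ≡⟨ +-assoc (σ N) (p * B) (p * M) ⟨
      σ N + p * B + p * M   ∎

  -- the same for sums of proper divisors: N·p^(a+1) = p·N·p^a is kept out by keeping N·p^a out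
  properlyPractical-primePower : p ≤ suc (σ N) → Practical N → ProperlyPractical N →
                                 ∀ a → ProperlyPractical (N * p ^ a)
  properlyPractical-primePower _ _ properlyPractical zero = subst ProperlyPractical (sym (*-identityʳ N)) properlyPractical
  properlyPractical-primePower p≤1+σ practical properlyPractical (suc a) t t+Np^[1+a]≤σ
    with digitDecomposition p≤1+σ (properTarget-bound a t t+Np^[1+a]≤σ)
  ... | r , u , r≤σN , u≤B , t≡r+pu
    with practical r r≤σN
       | properlyPractical-primePower p≤1+σ practical properlyPractical a u
           (subst (u + N * p ^ a ≤_) (σ-excess a) (+-monoˡ-≤ (N * p ^ a) u≤B))
  ... | c₁ , sum₁ | c₂ , c₂M≡false , sum₂ =
    glue c₁ c₂ , trans (cong (glue c₁ c₂) (N*p^[1+a] a)) (trans (glue-multiple c₁ c₂ (N * p ^ a)) c₂M≡false) ,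
    trans (partSum-glue id c₁ c₂ a) (trans (cong₂ (λ x y → x + p * y) sum₁ sum₂) (sym t≡r+pu))

  zumkeller-primePower : ZumkellerSplit N → ∀ a → ZumkellerSplit (N * p ^ a)
  zumkeller-primePower split zero = subst ZumkellerSplit (sym (*-identityʳ N)) split
  zumkeller-primePower split@(c₁ , balanced₁) (suc a) with zumkeller-primePower split a
  ... | c₂ , balanced₂ = glue c₁ c₂ , (begin
    partSum (glue c₁ c₂) (N * p ^ suc a)            ≡⟨ partSum-glue id c₁ c₂ a ⟩
    partSum c₁ N + p * partSum c₂ (N * p ^ a)       ≡⟨ cong₂ (λ x y → x + p * y) balanced₁ balanced₂ ⟩
    partSum c̄₁ N + p * partSum c̄₂ (N * p ^ a)       ≡⟨ partSum-glue not c₁ c₂ a ⟨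
    partSum (λ d → not (glue c₁ c₂ d)) (N * p ^ suc a) ∎)
    where
    c̄₁ c̄₂ : ℕ → Bool
    c̄₁ d = not (c₁ d)
    c̄₂ d = not (c₂ d)

  -- Likewise for half-Zumkeller colourings: the top divisor p·(N·p^a) stays in the `false` part.
  halfZumkeller-primePower : ZumkellerSplit N → HalfZumkellerSplit N → ∀ a → HalfZumkellerSplit (N * p ^ a)
  halfZumkeller-primePower _ halfSplit zero = subst HalfZumkellerSplit (sym (*-identityʳ N)) halfSplit
  halfZumkeller-primePower split@(c₁ , balanced₁) halfSplit (suc a) with halfZumkeller-primePower split halfSplit a
  ... | c₂ , c₂M≡false , balanced₂ =
    glue c₁ c₂ , trans (cong (glue c₁ c₂) (N*p^[1+a] a)) (trans (glue-multiple c₁ c₂ M) c₂M≡false) , (begin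
    partSum (glue c₁ c₂) (N * p ^ suc a) + N * p ^ suc a  ≡⟨ cong₂ _+_ (partSum-glue id c₁ c₂ a) (N*p^[1+a] a) ⟩
    partSum c₁ N + p * partSum c₂ M + p * M               ≡⟨ +-assoc (partSum c₁ N) _ _ ⟩
    partSum c₁ N + (p * partSum c₂ M + p * M)             ≡⟨ cong (partSum c₁ N +_) (*-distribˡ-+ p _ M) ⟨
    partSum c₁ N + p * (partSum c₂ M + M)                 ≡⟨ cong₂ (λ x y → x + p * y) balanced₁ balanced₂ ⟩
    partSum c̄₁ N + p * partSum c̄₂ M                       ≡⟨ partSum-glue not c₁ c₂ a ⟨
    partSum (λ d → not (glue c₁ c₂ d)) (N * p ^ suc a)    ∎)
    where
    M : ℕ
    M = N * p ^ a
    c̄₁ c̄₂ : ℕ → Bool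
    c̄₁ d = not (c₁ d)
    c̄₂ d = not (c₂ d)

  -- Obstruction: if σ N is odd and below p, no N·p^(a+1) is Zumkeller. Reading a balanced
  -- colouring's part sums x + p·X = y + p·Y with x + y = σ N < p forces x = y, so σ N = 2x.
  zumkeller-obstruction : ¬ 2 ∣ σ N → σ N < p → ∀ a → ¬ ZumkellerSplit (N * p ^ suc a)
  zumkeller-obstruction σN-odd σN<p a (c , balanced) = σN-odd (divides x (begin
    σ N    ≡⟨ partSum-complement c N ⟨
    x + y  ≡⟨ cong (x +_) x≡y ⟨
    x + x  ≡⟨ cong (x +_) (+-identityʳ x) ⟨
    2 * x  ≡⟨ *-comm 2 x ⟩
    x * 2  ∎))
    where
    x y : ℕ
    x = partSum c N
    y = partSum (λ d → not (c d)) N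
    x+y<p : x + y < p
    x+y<p = subst (_< p) (sym (partSum-complement c N)) σN<p
    x≡y : x ≡ y
    x≡y = smallRemainders (≤-<-trans (m≤m+n x y) x+y<p) (≤-<-trans (m≤n+m y x) x+y<p)
      (trans (sym (partSum-primePower a c)) (trans balanced (partSum-primePower a (λ d → not (c d)))))

  -- For odd p, σ(N·p^a) ≡ σ N · (a + 1) (mod 2): each factor p adds an odd multiple of σ(N·p^a).
  σ-primePower-parity : 2 < p → ∀ a → parity (σ (N * p ^ a)) ≡ parity (σ N) *ℙ parity (suc a)
  σ-primePower-parity 2<p zero = trans (cong (parity ∘ σ) (*-identityʳ N)) (sym (ℙ.*-identityʳ _))
  σ-primePower-parity 2<p (suc a) = begin
    parity (σ (N * p ^ suc a))                ≡⟨ cong parity (σ-primePower a) ⟩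
    parity (σ N + p * σ (N * p ^ a))          ≡⟨ +-homo-+ (σ N) _ ⟩
    P +ℙ parity (p * σ (N * p ^ a))           ≡⟨ cong (P +ℙ_) (*-homo-* p _) ⟩
    P +ℙ (parity p *ℙ parity (σ (N * p ^ a))) ≡⟨ cong₂ (λ x y → P +ℙ (x *ℙ y)) (oddPrime-parity p-prime 2<p)
                                                                        (σ-primePower-parity 2<p a) ⟩
    P +ℙ (1ℙ *ℙ (P *ℙ parity (suc a)))        ≡⟨ flip P (parity (suc a)) ⟩
    P *ℙ parity (suc a) ⁻¹                    ≡⟨ cong (P *ℙ_) (parity-suc (suc a)) ⟨
    P *ℙ parity (suc (suc a))                 ∎
    where
    P : Parity
    P = parity (σ N)
    flip : ∀ P q → P +ℙ (1ℙ *ℙ (P *ℙ q)) ≡ P *ℙ q ⁻¹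
    flip 0ℙ _  = refl
    flip 1ℙ 0ℙ = refl
    flip 1ℙ 1ℙ = refl

intervalInduction : ∀ (P : ℕ → Set) {j M} → P j → (∀ i → j ≤ i → i < M → P i → P (suc i)) →
                    ∀ i → j ≤ i → i ≤ M → P i
intervalInduction P Pj step zero    z≤n _ = Pj
intervalInduction P Pj step (suc i) j≤1+i 1+i≤M with m≤n⇒m<n∨m≡n j≤1+i
... | inj₂ refl = Pj
... | inj₁ j<1+i = step i (≤-pred j<1+i) 1+i≤M (intervalInduction P Pj step i (≤-pred j<1+i) (<⇒≤ 1+i≤M))

m<n⇒m≤n∸1 : ∀ {i n} → i < n → i ≤ n ∸ 1
m<n⇒m≤n∸1 (s≤s i≤n) = i≤n

prime∣x^a⇒prime∣x : ∀ {q x} a → Prime q → q ∣ x ^ a → q ∣ x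
prime∣x^a⇒prime∣x zero    q-prime q∣1 = contradiction (subst Prime (∣1⇒≡1 q∣1) q-prime) ¬prime[1]
prime∣x^a⇒prime∣x {x = x} (suc a) q-prime q∣x^[1+a] with euclidsLemma x (x ^ a) q-prime q∣x^[1+a]
... | inj₁ q∣x   = q∣x
... | inj₂ q∣x^a = prime∣x^a⇒prime∣x a q-prime q∣x^a

-- The factor 2^k of n is 1 extended by the prime 2.
module PowersOf2 = PrimePowerExtension prime[2] (λ 2∣1 → contradiction (∣1⇒≡1 2∣1) λ ()) {{_}}

-- σ(2^a) = 2^(a+1) − 1 is odd.
σ[2^a]-odd : ∀ a → parity (σ (1 * 2 ^ a)) ≡ 1ℙ
σ[2^a]-odd zero    = refl
σ[2^a]-odd (suc a) = begin
  parity (σ (1 * 2 ^ suc a))                 ≡⟨ cong parity (PowersOf2.σ-primePower a) ⟩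
  parity (σ 1 + 2 * σ (1 * 2 ^ a))           ≡⟨ +-homo-+ (σ 1) (2 * σ (1 * 2 ^ a)) ⟩
  parity (σ 1) +ℙ parity (2 * σ (1 * 2 ^ a)) ≡⟨ cong (parity (σ 1) +ℙ_) (*-homo-* 2 (σ (1 * 2 ^ a))) ⟩
  1ℙ +ℙ 0ℙ                                   ∎

practical-1 : Practical 1
practical-1 zero          _        = (λ _ → false) , refl
practical-1 (suc zero)    _        = (λ _ → true) , refl
practical-1 (suc (suc t)) (s≤s ())

properlyPractical-1 : ProperlyPractical 1
properlyPractical-1 zero    _       = (λ _ → false) , refl , refl
properlyPractical-1 (suc t) t+2≤σ1 = contradiction t+2≤σ1 (<⇒≱ (s≤s (m≤n+m 1 t)))

module PrefixProducts (k m : ℕ) (p e : ℕ → ℕ)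
  (1≤k          : 1 ≤ k)
  (p-prime      : ∀ i → 1 ≤ i → i ≤ m → Prime (p i))
  (p-odd        : ∀ i → 1 ≤ i → i ≤ m → 2 < p i)
  (p-increasing : ∀ i → 1 ≤ i → i < m → p i < p (i + 1))
  (e-positive   : ∀ i → 1 ≤ i → i ≤ m → 1 ≤ e i)
  where

  -- Pr i = 2^k p₁^{e₁} ⋯ p_{i−1}^{e_{i−1}}, so that n = Pr (m + 1)
  Pr : ℕ → ℕ
  Pr = prefixProd k p e

  Gap : ℕ → Set
  Gap i = σ (Pr i) + 1 < p i

  Pr-1 : Pr 1 ≡ 1 * 2 ^ k
  Pr-1 = trans (*-identityʳ (2 ^ k)) (sym (*-identityˡ (2 ^ k)))

  Pr-suc : ∀ i → 1 ≤ i → Pr (suc i) ≡ Pr i * p i ^ e i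
  Pr-suc (suc i) _ = sym (*-assoc (2 ^ k) _ _)

  Pr-nonZero : ∀ i → i ≤ suc m → NonZero (Pr i)
  Pr-nonZero zero          _        = m*n≢0 (2 ^ k) 1 {{m^n≢0 2 k}}
  Pr-nonZero (suc zero)    _        = m*n≢0 (2 ^ k) 1 {{m^n≢0 2 k}}
  Pr-nonZero (suc (suc i)) 2+i≤1+m = subst NonZero (sym (Pr-suc (suc i) (s≤s z≤n)))
    (m*n≢0 _ _ {{Pr-nonZero (suc i) (<⇒≤ 2+i≤1+m)}} {{m^n≢0 (p (suc i)) (e (suc i)) {{prime⇒nonZero pᵢ-prime}}}})
    where
    pᵢ-prime : Prime (p (suc i))
    pᵢ-prime = p-prime (suc i) (s≤s z≤n) (≤-pred 2+i≤1+m)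

  Pr-even : ∀ i → 2 ∣ Pr i
  Pr-even i = ∣m⇒∣m*n _ (2∣2^a 1≤k)
    where
    2∣2^a : ∀ {a} → 1 ≤ a → 2 ∣ 2 ^ a
    2∣2^a {suc a} _ = m∣m*n (2 ^ a)

  p-strictlyIncreasing : ∀ l i → 1 ≤ l → l < i → i ≤ m → p l < p i
  p-strictlyIncreasing l (suc i) 1≤l l<1+i 1+i≤m with m≤n⇒m<n∨m≡n (≤-pred l<1+i)
  ... | inj₂ refl = subst (λ j → p l < p j) (+-comm l 1) (p-increasing l 1≤l 1+i≤m)
  ... | inj₁ l<i  = <-trans (p-strictlyIncreasing l i 1≤l l<i (<⇒≤ 1+i≤m))
                            (subst (λ j → p i < p j) (+-comm i 1) (p-increasing i (≤-trans 1≤l (<⇒≤ l<i)) 1+i≤m))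

  -- p_i ∤ Pr i: p_i is odd, so p_i ∤ 2^k, and p_i differs from the smaller primes p_l, l < i
  p∤2^k : ∀ i → 1 ≤ i → i ≤ m → ¬ p i ∣ 2 ^ k
  p∤2^k i 1≤i i≤m p∣2^k = <⇒≱ (p-odd i 1≤i i≤m) (∣⇒≤ (prime∣x^a⇒prime∣x k (p-prime i 1≤i i≤m) p∣2^k))

  p∤earlierPowers : ∀ i → 1 ≤ i → i ≤ m → ∀ j → j < i → ¬ p i ∣ prodTo (λ l → p l ^ e l) j
  p∤earlierPowers i 1≤i i≤m zero    _   p∣1 = ¬prime[1] (subst Prime (∣1⇒≡1 p∣1) (p-prime i 1≤i i≤m))
  p∤earlierPowers i 1≤i i≤m (suc j) 1+j<i p∣ with euclidsLemma _ _ (p-prime i 1≤i i≤m) p∣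
  ... | inj₁ p∣prod = p∤earlierPowers i 1≤i i≤m j (<-trans (n<1+n j) 1+j<i) p∣prod
  ... | inj₂ p∣pow with prime⇒irreducible (p-prime (suc j) (s≤s z≤n) (≤-trans (<⇒≤ 1+j<i) i≤m))
                                          (prime∣x^a⇒prime∣x (e (suc j)) (p-prime i 1≤i i≤m) p∣pow)
  ...   | inj₁ pᵢ≡1 = ¬prime[1] (subst Prime pᵢ≡1 (p-prime i 1≤i i≤m))
  ...   | inj₂ pᵢ≡pⱼ = <⇒≢ (p-strictlyIncreasing (suc j) i (s≤s z≤n) 1+j<i i≤m) (sym pᵢ≡pⱼ)

  p∤Pr : ∀ i → 1 ≤ i → i ≤ m → ¬ p i ∣ Pr i
  p∤Pr (suc i) 1≤i i≤m p∣Pr with euclidsLemma (2 ^ k) _ (p-prime (suc i) 1≤i i≤m) p∣Pr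
  ... | inj₁ p∣2^k  = p∤2^k (suc i) 1≤i i≤m p∣2^k
  ... | inj₂ p∣prod = p∤earlierPowers (suc i) 1≤i i≤m i ≤-refl p∣prod

  noGap⇒p≤1+σ : ∀ i → ¬ Gap i → p i ≤ suc (σ (Pr i))
  noGap⇒p≤1+σ i noGap = subst (p i ≤_) (+-comm (σ (Pr i)) 1) (≮⇒≥ noGap)

  module Extension {i} (1≤i : 1 ≤ i) (i≤m : i ≤ m) =
    PrimePowerExtension (p-prime i 1≤i i≤m) (p∤Pr i 1≤i i≤m) {{Pr-nonZero i (m≤n⇒m≤1+n i≤m)}}

  practicalPrefix : ∀ i → i ≤ m → (∀ l → 1 ≤ l → l ≤ i → ¬ Gap l) →
                    Practical (Pr (suc i)) × ProperlyPractical (Pr (suc i))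
  practicalPrefix zero _ _ = subst (λ x → Practical x × ProperlyPractical x) (sym Pr-1)
    ( PowersOf2.practical-primePower ≤-refl practical-1 k
    , PowersOf2.properlyPractical-primePower ≤-refl practical-1 properlyPractical-1 k)
  practicalPrefix (suc i) 1+i≤m noGap
    with practicalPrefix i (<⇒≤ 1+i≤m) (λ l 1≤l l≤i → noGap l 1≤l (m≤n⇒m≤1+n l≤i))
  ... | practical , properlyPractical =
    subst (λ x → Practical x × ProperlyPractical x) (sym (Pr-suc (suc i) (s≤s z≤n)))
      ( E.practical-primePower pᵢ≤1+σ practical (e (suc i))
      , E.properlyPractical-primePower pᵢ≤1+σ practical properlyPractical (e (suc i)))
    where
    module E = Extension (s≤s z≤n) 1+i≤m
    pᵢ≤1+σ : p (suc i) ≤ suc (σ (Pr (suc i)))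
    pᵢ≤1+σ = noGap⇒p≤1+σ (suc i) (noGap (suc i) (s≤s z≤n) ≤-refl)

  evenPractical⇒splits : ∀ i → i ≤ m → Practical (Pr (suc i)) → ProperlyPractical (Pr (suc i)) →
                         2 ∣ σ (Pr (suc i)) → ZumkellerSplit (Pr (suc i)) × HalfZumkellerSplit (Pr (suc i))
  evenPractical⇒splits i i≤m practical properlyPractical σ-even =
    practical⇒ZumkellerSplit (Pr (suc i)) practical σ-even ,
    properlyPractical⇒HalfZumkellerSplit (Pr (suc i)) {{Pr-nonZero (suc i) (s≤s i≤m)}}
                                         properlyPractical σ-even (Pr-even (suc i))

  splitsPropagate : ∀ j → 1 ≤ j → j ≤ suc m → ZumkellerSplit (Pr j) × HalfZumkellerSplit (Pr j) →
                    HalfZumkellerSplit (Pr (suc m))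
  splitsPropagate j 1≤j j≤1+m splits =
    proj₂ (intervalInduction (λ i → ZumkellerSplit (Pr i) × HalfZumkellerSplit (Pr i)) splits step (suc m) j≤1+m ≤-refl)
    where
    step : ∀ i → j ≤ i → i < suc m → ZumkellerSplit (Pr i) × HalfZumkellerSplit (Pr i) →
           ZumkellerSplit (Pr (suc i)) × HalfZumkellerSplit (Pr (suc i))
    step i j≤i i<1+m (split , halfSplit) =
      subst (λ x → ZumkellerSplit x × HalfZumkellerSplit x) (sym (Pr-suc i 1≤i))
      (E.zumkeller-primePower split (e i) , E.halfZumkeller-primePower split halfSplit (e i))
      where
      1≤i : 1 ≤ i
      1≤i = ≤-trans 1≤j j≤i
      module E = Extension 1≤i (≤-pred i<1+m)

  σPr-parity : ∀ i → 1 ≤ i → i ≤ m → parity (σ (Pr (suc i))) ≡ parity (σ (Pr i)) *ℙ parity (suc (e i))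
  σPr-parity i 1≤i i≤m =
    trans (cong (parity ∘ σ) (Pr-suc i 1≤i)) (Extension.σ-primePower-parity 1≤i i≤m (p-odd i 1≤i i≤m) (e i))

  σPr-odd : ∀ i → i ≤ m → (∀ l → 1 ≤ l → l ≤ i → 2 ∣ e l) → parity (σ (Pr (suc i))) ≡ 1ℙ
  σPr-odd zero    _     _     = trans (cong (parity ∘ σ) Pr-1) (σ[2^a]-odd k)
  σPr-odd (suc i) 1+i≤m evens = trans (σPr-parity (suc i) (s≤s z≤n) 1+i≤m) (cong₂ _*ℙ_
    (σPr-odd i (<⇒≤ 1+i≤m) (λ l 1≤l l≤i → evens l 1≤l (m≤n⇒m≤1+n l≤i)))
    (parity-suc-even (evens (suc i) (s≤s z≤n) ≤-refl)))

  σPr-even : ∀ l → 1 ≤ l → l ≤ m → ¬ 2 ∣ e l → ∀ j → l < j → j ≤ suc m → parity (σ (Pr j)) ≡ 0ℙ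
  σPr-even l 1≤l l≤m eₗ-odd = intervalInduction (λ j → parity (σ (Pr j)) ≡ 0ℙ) base step
    where
    base : parity (σ (Pr (suc l))) ≡ 0ℙ
    base = trans (σPr-parity l 1≤l l≤m)
                 (trans (cong (parity (σ (Pr l)) *ℙ_) (parity-suc-odd (e l) eₗ-odd)) (ℙ.*-zeroʳ _))
    step : ∀ i → suc l ≤ i → i < suc m → parity (σ (Pr i)) ≡ 0ℙ → parity (σ (Pr (suc i))) ≡ 0ℙ
    step i l<i i<1+m σᵢ-even =
      trans (σPr-parity i (≤-trans 1≤l (<⇒≤ l<i)) (≤-pred i<1+m)) (cong (_*ℙ parity (suc (e i))) σᵢ-even)

  module _ (n-split : ZumkellerSplit (Pr (suc m))) (n-notHalf : ¬ HalfZumkellerSplit (Pr (suc m))) where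

    -- Without any gap n would be practical with even σ, hence half-Zumkeller.
    gapExists : ∃ λ i → 1 ≤ i × i ≤ m × Gap i
    gapExists with anyUpTo? (λ i → σ (Pr (suc i)) + 1 <? p (suc i)) m
    ... | yes (i , i<m , gap) = suc i , s≤s z≤n , i<m , gap
    ... | no  noGap with practicalPrefix m ≤-refl (λ { (suc l) _ l<m gap → noGap (l , l<m , gap) })
    ...   | practical , properlyPractical = contradiction
      (proj₂ (evenPractical⇒splits m ≤-refl practical properlyPractical (ZumkellerSplit⇒2∣σ (Pr (suc m)) n-split)))
      n-notHalf

    -- At the first gap j, an odd exponent e_l (l < j) would make the practical prefix Pr j have
    -- even σ, so Pr j and then n would be half-Zumkeller.
    evenBeforeFirstGap : ∀ j → 1 ≤ j → j ≤ m → (∀ i → 1 ≤ i → i < j → ¬ Gap i) →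
                         ∀ l → 1 ≤ l → l < j → 2 ∣ e l
    evenBeforeFirstGap (suc j) _ 1+j≤m noEarlierGap l 1≤l l<1+j with 2 ∣? e l
    ... | yes 2∣eₗ = 2∣eₗ
    ... | no  eₗ-odd with practicalPrefix j (<⇒≤ 1+j≤m) (λ i 1≤i i≤j → noEarlierGap i 1≤i (s≤s i≤j))
    ...   | practical , properlyPractical = contradiction
      (splitsPropagate (suc j) (s≤s z≤n) (m≤n⇒m≤1+n 1+j≤m)
        (evenPractical⇒splits j (<⇒≤ 1+j≤m) practical properlyPractical σⱼ-even))
      n-notHalf
      where
      σⱼ-even : 2 ∣ σ (Pr (suc j))
      σⱼ-even = parity≡0ℙ⇒2∣ _
        (σPr-even l 1≤l (≤-trans (<⇒≤ l<1+j) 1+j≤m) eₗ-odd (suc j) l<1+j (m≤n⇒m≤1+n 1+j≤m))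

    -- The first gap is not at m: there σ(Pr m) would be odd and below p_m, so that
    -- n = Pr m · p_m^(e_m) could not be Zumkeller.
    firstGap≢m : ∀ j → 1 ≤ j → j ≤ m → Gap j → (∀ l → 1 ≤ l → l < j → 2 ∣ e l) → j ≢ m
    firstGap≢m (suc j) 1≤j 1+j≤m gap evens 1+j≡m with e (suc j) in eⱼ≡1+a | e-positive (suc j) 1≤j 1+j≤m
    ... | suc a | _ = E.zumkeller-obstruction σ-odd σ<p a (subst ZumkellerSplit n≡ n-split)
      where
      module E = Extension 1≤j 1+j≤m
      σ-odd : ¬ 2 ∣ σ (Pr (suc j))
      σ-odd = odd⇒¬2∣ (σPr-odd j (<⇒≤ 1+j≤m) (λ l 1≤l l≤j → evens l 1≤l (s≤s l≤j)))
      σ<p : σ (Pr (suc j)) < p (suc j)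
      σ<p = ≤-trans (s≤s (m≤m+n _ 1)) gap
      n≡ : Pr (suc m) ≡ Pr (suc j) * p (suc j) ^ suc a
      n≡ = trans (cong (Pr ∘ suc) (sym 1+j≡m))
                 (trans (Pr-suc (suc j) 1≤j) (cong (λ x → Pr (suc j) * p (suc j) ^ x) eⱼ≡1+a))

mainTheorem19 : (n k m : ℕ) (p e : ℕ → ℕ) →
    1 ≤ k →
    (∀ i → 1 ≤ i → i ≤ m → Prime (p i)) →
    (∀ i → 1 ≤ i → i ≤ m → 2 < p i) →
    (∀ i → 1 ≤ i → i < m → p i < p (i + 1)) →
    (∀ i → 1 ≤ i → i ≤ m → 1 ≤ e i) →
    n ≡ prefixProd k p e (m + 1) →
    Zumkeller n →
    ¬ HalfZumkeller n →
    (∃ λ i → 1 ≤ i × i ≤ m × σ (prefixProd k p e i) + 1 < p i)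
    × (∀ j → 1 ≤ j → j ≤ m → σ (prefixProd k p e j) + 1 < p j →
         (∀ i → 1 ≤ i → i < j → ¬ (σ (prefixProd k p e i) + 1 < p i)) →
         (∀ l → 1 ≤ l → l < j → 2 ∣ e l) × j ≤ m ∸ 1)
mainTheorem19 n k m p e 1≤k p-prime p-odd p-increasing e-positive n≡Pr[m+1] zumkeller notHalf =
  gapExists n-split n-notHalf , firstGap
  where
  open PrefixProducts k m p e 1≤k p-prime p-odd p-increasing e-positive
  n≡Pr : n ≡ Pr (suc m)
  n≡Pr = trans n≡Pr[m+1] (cong Pr (+-comm m 1))
  n-split : ZumkellerSplit (Pr (suc m))
  n-split = Zumkeller⇒split (Pr (suc m)) (subst Zumkeller n≡Pr zumkeller)
  n-notHalf : ¬ HalfZumkellerSplit (Pr (suc m))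
  n-notHalf = notHalf ∘ subst HalfZumkeller (sym n≡Pr) ∘ split⇒HalfZumkeller (Pr (suc m)) {{Pr-nonZero (suc m) ≤-refl}}
  firstGap : ∀ j → 1 ≤ j → j ≤ m → Gap j → (∀ i → 1 ≤ i → i < j → ¬ Gap i) →
             (∀ l → 1 ≤ l → l < j → 2 ∣ e l) × j ≤ m ∸ 1
  firstGap j 1≤j j≤m gap noEarlierGap =
    evens , m<n⇒m≤n∸1 (≤∧≢⇒< j≤m (firstGap≢m n-split n-notHalf j 1≤j j≤m gap evens))
    where
    evens : ∀ l → 1 ≤ l → l < j → 2 ∣ e l
    evens = evenBeforeFirstGap n-split n-notHalf j 1≤j j≤m noEarlierGap
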